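{- Suppose $G$ and $H$ are good graphs. Then $\gamma(G\square H)=\gamma(G)\gamma(H)$ if and only if $G\square H$ is good.
   Context: All graphs are finite and connected. A pebbling step removes two pebbles from a vertex and places one pebble on an adjacent vertex. The cover pebbling number $\gamma(G)$ is the minimum $N$ such that for every placement of $N$ pebbles on $G$ some sequence of pebbling steps leaves at least one pebble on every vertex. A graph $G$ is good if $\gamma(G)=\sum_{w\in V(G)}2^{\mathrm{dist}(w,u)}$ for some vertex $u\in V(G)$. $G\square H$ is the Cartesian product: vertex set $V(G)\times V(H)$, with $(w,v)\sim(w',v')$ iff ($w=w'$ and $v\sim v'$) or ($v=v'$ and $w\sim w'$). -}

module Defs where

open import Data.Nat using (ℕ; zero; suc; _+_; _*_; _^_; _≤_)
open import Data.Fin using (Fin; zero; suc; combine; remQuot)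
open import Data.Product using (Σ; ∃; _×_; _,_; proj₁; proj₂)
open import Data.Sum using (_⊎_)
open import Relation.Binary.PropositionalEquality using (_≡_; _≢_)
open import Relation.Binary.Construct.Closure.ReflexiveTransitive using (Star)
open import Relation.Nullary using (¬_)


record Graph : Set₁ where
  field
    n   : ℕ
    Adj : Fin n → Fin n → Set
open Graph public

data Walk (G : Graph) : Fin (n G) → Fin (n G) → ℕ → Set where
  here : ∀ {v} → Walk G v v 0
  step : ∀ {u v w k} → Adj G u v → Walk G v w k → Walk G u w (suc k)

IsFiniteSimpleConnected : Graph → Set
IsFiniteSimpleConnected G =
  (∀ u v → Adj G u v → Adj G v u) ×
  (∀ u → ¬ Adj G u u) ×
  (∀ u v → ∃ λ k → Walk G u v k)

IsDist : (G : Graph) → Fin (n G) → Fin (n G) → ℕ → Set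
IsDist G w u d = Walk G w u d × (∀ k → Walk G w u k → d ≤ k)

sumFin : ∀ {m} → (Fin m → ℕ) → ℕ
sumFin {zero}  f = 0
sumFin {suc m} f = f zero + sumFin (λ i → f (suc i))

Config : Graph → Set
Config G = Fin (n G) → ℕ

PebStep : (G : Graph) → Config G → Config G → Set
PebStep G p q = Σ (Fin (n G)) λ v → Σ (Fin (n G)) λ w →
  Adj G v w × 2 ≤ p v × q v + 2 ≡ p v × q w ≡ suc (p w) ×
  (∀ x → x ≢ v → x ≢ w → q x ≡ p x)

Reach : (G : Graph) → Config G → Config G → Set
Reach G = Star (PebStep G)

Covered : (G : Graph) → Config G → Set
Covered G q = ∀ v → 1 ≤ q v

CoverSolvable : (G : Graph) → Config G → Set
CoverSolvable G p = ∃ λ q → Reach G p q × Covered G q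

AllCoverSolvable : Graph → ℕ → Set
AllCoverSolvable G N = ∀ (p : Config G) → sumFin p ≡ N → CoverSolvable G p

IsCoverPebblingNumber : Graph → ℕ → Set
IsCoverPebblingNumber G N =
  AllCoverSolvable G N × (∀ M → AllCoverSolvable G M → N ≤ M)

Good : Graph → Set
Good G = Σ (Fin (n G)) λ u → Σ (Fin (n G) → ℕ) λ d →
  (∀ w → IsDist G w u (d w)) ×
  IsCoverPebblingNumber G (sumFin (λ w → 2 ^ d w))

-- Cartesian product; vertex (a , b) is encoded as combine a b : Fin (nG * nH).
_□_ : Graph → Graph → Graph
G □ H = record
  { n   = n G * n H
  ; Adj = λ x y →
      let a = proj₁ (remQuot {n G} (n H) x) ; b = proj₂ (remQuot {n G} (n H) x)
          a' = proj₁ (remQuot {n G} (n H) y) ; b' = proj₂ (remQuot {n G} (n H) y)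
      in (a ≡ a' × Adj H b b') ⊎ (b ≡ b' × Adj G a a')
  }

-- Let d vanish at v and grow by at most one along each edge.  The potential Σ p(x)·2^d(x) of a
-- configuration p never increases under a pebbling step, is at least Σ 2^d(x) once every vertex
-- is covered, and equals N for N pebbles on v; hence Σ 2^d(x) ≤ γ.  In G □ H the distance to
-- (a , b) is dist(·, a) + dist(·, b), so its sum Σ 2^dist factors as the product of the sums for
-- G at a and H at b.  With a, b the centres witnessing goodness of G and H this gives
-- γ(G)γ(H) ≤ γ(G □ H), with equality exactly when G □ H is good at (a , b).  Conversely, if G □ H
-- is good at some (a , b), its distances split into distances in the fibres through (a , b), and
-- γ(G □ H) is a product of two sums bounded by γ(G) and γ(H).
module Submission where

open import Defs
open import Data.Nat using (ℕ; zero; suc; _+_; _*_; _^_; _≤_; z≤n)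
open import Data.Nat.Properties
open import Algebra.Properties.CommutativeSemigroup +-commutativeSemigroup using (interchange)
open import Data.Fin using (Fin; zero; suc; combine; remQuot; _↑ˡ_; _↑ʳ_)
open import Data.Fin.Properties using (remQuot-combine; combine-remQuot) renaming (_≟_ to _≟ᶠ_)
open import Data.Product using (Σ; _×_; _,_; proj₁; proj₂)
open import Data.Sum using (inj₁; inj₂)
open import Data.Empty using (⊥-elim)
open import Function using (_∘_)
open import Relation.Binary.PropositionalEquality
open import Relation.Binary.Construct.Closure.ReflexiveTransitive using (ε; _◅_)
open import Relation.Nullary using (yes; no)

sumFin-cong : ∀ {m} {f g : Fin m → ℕ} → (∀ x → f x ≡ g x) → sumFin f ≡ sumFin g
sumFin-cong {zero}  e = refl
sumFin-cong {suc m} e = cong₂ _+_ (e zero) (sumFin-cong (e ∘ suc))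

sumFin-mono-≤ : ∀ {m} {f g : Fin m → ℕ} → (∀ x → f x ≤ g x) → sumFin f ≤ sumFin g
sumFin-mono-≤ {zero}  e = z≤n
sumFin-mono-≤ {suc m} e = +-mono-≤ (e zero) (sumFin-mono-≤ (e ∘ suc))

sumFin-zero : ∀ m → sumFin {m} (λ _ → 0) ≡ 0
sumFin-zero zero    = refl
sumFin-zero (suc m) = sumFin-zero m

sumFin-distrib-+ : ∀ {m} (f g : Fin m → ℕ) → sumFin (λ x → f x + g x) ≡ sumFin f + sumFin g
sumFin-distrib-+ {zero}  f g = refl
sumFin-distrib-+ {suc m} f g =
  trans (cong (f zero + g zero +_) (sumFin-distrib-+ (f ∘ suc) (g ∘ suc)))
        (interchange (f zero) (g zero) (sumFin (f ∘ suc)) (sumFin (g ∘ suc)))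

sumFin-distribˡ-* : ∀ {m} c (f : Fin m → ℕ) → sumFin (λ x → c * f x) ≡ c * sumFin f
sumFin-distribˡ-* {zero}  c f = sym (*-zeroʳ c)
sumFin-distribˡ-* {suc m} c f =
  trans (cong (c * f zero +_) (sumFin-distribˡ-* c (f ∘ suc))) (sym (*-distribˡ-+ c (f zero) _))

sumFin-distribʳ-* : ∀ {m} c (f : Fin m → ℕ) → sumFin (λ x → f x * c) ≡ sumFin f * c
sumFin-distribʳ-* c f =
  trans (sumFin-cong (λ x → *-comm (f x) c)) (trans (sumFin-distribˡ-* c f) (*-comm c (sumFin f)))

sumFin-splitAt : ∀ m k (f : Fin (m + k) → ℕ) →
  sumFin f ≡ sumFin (λ i → f (i ↑ˡ k)) + sumFin (λ j → f (m ↑ʳ j))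
sumFin-splitAt zero    k f = refl
sumFin-splitAt (suc m) k f =
  trans (cong (f zero +_) (sumFin-splitAt m k (f ∘ suc))) (sym (+-assoc (f zero) _ _))

sumFin-combine : ∀ m k (f : Fin (m * k) → ℕ) →
  sumFin f ≡ sumFin {m} (λ i → sumFin {k} (λ j → f (combine i j)))
sumFin-combine zero    k f = refl
sumFin-combine (suc m) k f =
  trans (sumFin-splitAt k (m * k) f) (cong (sumFin (λ j → f (j ↑ˡ (m * k))) +_) (sumFin-combine m k (f ∘ (k ↑ʳ_))))

δ : ∀ {m} → Fin m → ℕ → Fin m → ℕ
δ zero    c zero    = c
δ zero    c (suc x) = 0
δ (suc a) c zero    = 0
δ (suc a) c (suc x) = δ a c x

δ-self : ∀ {m} (a : Fin m) c → δ a c a ≡ c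
δ-self zero    c = refl
δ-self (suc a) c = δ-self a c

δ-other : ∀ {m} {a x : Fin m} c → x ≢ a → δ a c x ≡ 0
δ-other {a = zero}  {zero}  c x≢a = ⊥-elim (x≢a refl)
δ-other {a = zero}  {suc x} c x≢a = refl
δ-other {a = suc a} {zero}  c x≢a = refl
δ-other {a = suc a} {suc x} c x≢a = δ-other c (x≢a ∘ cong suc)

sumFin-δ : ∀ {m} (a : Fin m) c → sumFin (δ a c) ≡ c
sumFin-δ {suc m} zero    c = trans (cong (c +_) (sumFin-zero m)) (+-identityʳ c)
sumFin-δ {suc m} (suc a) c = sumFin-δ a c

sumFin-δ-* : ∀ {m} (a : Fin m) c (g : Fin m → ℕ) → sumFin (λ x → δ a c x * g x) ≡ c * g a
sumFin-δ-* {suc m} zero    c g = trans (cong (c * g zero +_) (sumFin-zero m)) (+-identityʳ _)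
sumFin-δ-* {suc m} (suc a) c g = sumFin-δ-* a c (g ∘ suc)

sumFin-+δ-* : ∀ {m} (p : Fin m → ℕ) a c (g : Fin m → ℕ) →
  sumFin (λ x → (p x + δ a c x) * g x) ≡ sumFin (λ x → p x * g x) + c * g a
sumFin-+δ-* p a c g = begin
  sumFin (λ x → (p x + δ a c x) * g x)                     ≡⟨ sumFin-cong (λ x → *-distribʳ-+ (g x) (p x) _) ⟩
  sumFin (λ x → p x * g x + δ a c x * g x)                 ≡⟨ sumFin-distrib-+ (λ x → p x * g x) (λ x → δ a c x * g x) ⟩
  sumFin (λ x → p x * g x) + sumFin (λ x → δ a c x * g x)  ≡⟨ cong (sumFin (λ x → p x * g x) +_) (sumFin-δ-* a c g) ⟩
  sumFin (λ x → p x * g x) + c * g a                       ∎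
  where open ≡-Reasoning

weight : ∀ {m} → (Fin m → ℕ) → ℕ
weight d = sumFin (λ x → 2 ^ d x)

potential : ∀ {m} → (Fin m → ℕ) → (Fin m → ℕ) → ℕ
potential d p = sumFin (λ x → p x * 2 ^ d x)

Lipschitz : (G : Graph) → (Fin (n G) → ℕ) → Set
Lipschitz G d = ∀ x y → Adj G x y → d y ≤ suc (d x)

pebStep-balance : ∀ {G p q} → PebStep G p q →
  Σ (Fin (n G)) λ v → Σ (Fin (n G)) λ w → Adj G v w × (∀ x → q x + δ v 2 x ≡ p x + δ w 1 x)
pebStep-balance {p = p} {q} (v , w , adj , _ , qv , qw , rest) = v , w , adj , balance
  where
  balance : ∀ x → q x + δ v 2 x ≡ p x + δ w 1 x
  balance x with x ≟ᶠ v | x ≟ᶠ w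
  ... | yes refl | yes refl =
    ⊥-elim (m+1+n≢m (p x) (trans (+-suc (p x) 2) (trans (cong (_+ 2) (sym qw)) qv)))
  ... | yes refl | no x≢w rewrite δ-self x 2 | δ-other 1 x≢w = trans qv (sym (+-identityʳ (p x)))
  ... | no x≢v | yes refl rewrite δ-other 2 x≢v | δ-self x 1 =
    trans (+-identityʳ (q x)) (trans qw (+-comm 1 (p x)))
  ... | no x≢v | no x≢w rewrite δ-other 2 x≢v | δ-other 1 x≢w = cong (_+ 0) (rest x x≢v x≢w)

pebStep-potential-≤ : ∀ {G d p q} → Lipschitz G d → PebStep G p q → potential d q ≤ potential d p
pebStep-potential-≤ {d = d} {p} {q} lip move with pebStep-balance move
... | v , w , adj , balance = +-cancelʳ-≤ (2 * 2 ^ d v) (potential d q) (potential d p) (begin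
  potential d q + 2 * 2 ^ d v                      ≡⟨ sumFin-+δ-* q v 2 (λ x → 2 ^ d x) ⟨
  sumFin (λ x → (q x + δ v 2 x) * 2 ^ d x)         ≡⟨ sumFin-cong (λ x → cong (_* 2 ^ d x) (balance x)) ⟩
  sumFin (λ x → (p x + δ w 1 x) * 2 ^ d x)         ≡⟨ sumFin-+δ-* p w 1 (λ x → 2 ^ d x) ⟩
  potential d p + 1 * 2 ^ d w                      ≤⟨ +-monoʳ-≤ (potential d p) 2^dw≤2^suc-dv ⟩
  potential d p + 2 * 2 ^ d v                      ∎)
  where
  open ≤-Reasoning
  2^dw≤2^suc-dv : 1 * 2 ^ d w ≤ 2 * 2 ^ d v
  2^dw≤2^suc-dv = subst (_≤ 2 ^ suc (d v)) (sym (*-identityˡ _)) (^-monoʳ-≤ 2 (lip v w adj))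

reach-potential-≤ : ∀ {G d p q} → Lipschitz G d → Reach G p q → potential d q ≤ potential d p
reach-potential-≤ lip ε          = ≤-refl
reach-potential-≤ lip (move ◅ r) = ≤-trans (reach-potential-≤ lip r) (pebStep-potential-≤ lip move)

covered-weight-≤ : ∀ {G} d {q} → Covered G q → weight d ≤ potential d q
covered-weight-≤ d {q} cov =
  sumFin-mono-≤ (λ x → subst (_≤ q x * 2 ^ d x) (*-identityˡ (2 ^ d x)) (*-monoˡ-≤ (2 ^ d x) (cov x)))

weight-≤-cover : ∀ {G d} v → Lipschitz G d → d v ≡ 0 → ∀ {N} → AllCoverSolvable G N → weight d ≤ N
weight-≤-cover {G} {d} v lip dv≡0 {N} solvable with solvable (δ v N) (sumFin-δ v N)
... | q , reach , covered = begin
  weight d                ≤⟨ covered-weight-≤ {G} d covered ⟩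
  potential d q           ≤⟨ reach-potential-≤ lip reach ⟩
  potential d (δ v N)     ≡⟨ sumFin-δ-* v N (λ x → 2 ^ d x) ⟩
  N * 2 ^ d v             ≡⟨ cong (λ k → N * 2 ^ k) dv≡0 ⟩
  N * 1                   ≡⟨ *-identityʳ N ⟩
  N                       ∎
  where open ≤-Reasoning

_++ʷ_ : ∀ {G u v w k l} → Walk G u v k → Walk G v w l → Walk G u w (k + l)
here       ++ʷ q = q
step adj p ++ʷ q = step adj (p ++ʷ q)

Undirected : Graph → Set
Undirected G = ∀ u v → Adj G u v → Adj G v u

IsDistanceTo : (G : Graph) → Fin (n G) → (Fin (n G) → ℕ) → Set
IsDistanceTo G u d = ∀ w → IsDist G w u (d w)

IsDist-unique : ∀ {G w u d d′} → IsDist G w u d → IsDist G w u d′ → d ≡ d′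
IsDist-unique (p , shortest) (p′ , shortest′) = ≤-antisym (shortest _ p′) (shortest′ _ p)

IsDist-intro : ∀ {G w u d k} → (∀ l → Walk G w u l → d ≤ l) → Walk G w u k → k ≤ d → IsDist G w u d
IsDist-intro {G} {w} {u} shortest p k≤d =
  subst (Walk G w u) (≤-antisym k≤d (shortest _ p)) p , shortest

distance-self : ∀ {G u d} → IsDistanceTo G u d → d u ≡ 0
distance-self dist = n≤0⇒n≡0 (proj₂ (dist _) 0 here)

distance-lipschitz : ∀ {G u d} → Undirected G → IsDistanceTo G u d → Lipschitz G d
distance-lipschitz undirected dist x y adj =
  proj₂ (dist y) _ (step (undirected x y adj) (proj₁ (dist x)))

distance-weight-≤-cover : ∀ {G u d} → Undirected G → IsDistanceTo G u d →
  ∀ {N} → AllCoverSolvable G N → weight d ≤ N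
distance-weight-≤-cover undirected dist =
  weight-≤-cover _ (distance-lipschitz undirected dist) (distance-self dist)

cover-number-unique : ∀ {G M N} → IsCoverPebblingNumber G M → IsCoverPebblingNumber G N → M ≡ N
cover-number-unique (solvableM , leastM) (solvableN , leastN) =
  ≤-antisym (leastM _ solvableN) (leastN _ solvableM)

module Product (G H : Graph) where

  fst : Fin (n (G □ H)) → Fin (n G)
  fst x = proj₁ (remQuot {n G} (n H) x)

  snd : Fin (n (G □ H)) → Fin (n H)
  snd x = proj₂ (remQuot {n G} (n H) x)

  fst-combine : ∀ a b → fst (combine a b) ≡ a
  fst-combine a b = cong proj₁ (remQuot-combine {n G} {n H} a b)

  snd-combine : ∀ a b → snd (combine a b) ≡ b
  snd-combine a b = cong proj₂ (remQuot-combine {n G} {n H} a b)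

  combine-fst-snd : ∀ x → combine (fst x) (snd x) ≡ x
  combine-fst-snd = combine-remQuot {n G} (n H)

  □-undirected : Undirected G → Undirected H → Undirected (G □ H)
  □-undirected undirectedG undirectedH x y (inj₁ (x₁≡y₁ , adj)) = inj₁ (sym x₁≡y₁ , undirectedH _ _ adj)
  □-undirected undirectedG undirectedH x y (inj₂ (x₂≡y₂ , adj)) = inj₂ (sym x₂≡y₂ , undirectedG _ _ adj)

  lift₁ : ∀ {a a′ k} (b : Fin (n H)) → Walk G a a′ k → Walk (G □ H) (combine a b) (combine a′ b) k
  lift₁ b here = here
  lift₁ {a} b (step {v = v} adj p) = step adjacent (lift₁ b p)
    where
    adjacent : Adj (G □ H) (combine a b) (combine v b)
    adjacent = inj₂ ( trans (snd-combine a b) (sym (snd-combine v b))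
                    , subst₂ (Adj G) (sym (fst-combine a b)) (sym (fst-combine v b)) adj)

  lift₂ : ∀ {b b′ k} (a : Fin (n G)) → Walk H b b′ k → Walk (G □ H) (combine a b) (combine a b′) k
  lift₂ a here = here
  lift₂ {b} a (step {v = v} adj p) = step adjacent (lift₂ a p)
    where
    adjacent : Adj (G □ H) (combine a b) (combine a v)
    adjacent = inj₁ ( trans (fst-combine a b) (sym (fst-combine a v))
                    , subst₂ (Adj H) (sym (snd-combine a b)) (sym (snd-combine a v)) adj)

  project : ∀ {x y k} → Walk (G □ H) x y k →
    Σ ℕ λ k₁ → Σ ℕ λ k₂ → Walk G (fst x) (fst y) k₁ × Walk H (snd x) (snd y) k₂ × k₁ + k₂ ≡ k
  project here = 0 , 0 , here , here , refl
  project (step (inj₁ (x₁≡v₁ , adj)) p) with project p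
  ... | k₁ , k₂ , p₁ , p₂ , k₁+k₂≡k =
    k₁ , suc k₂ , subst (λ s → Walk G s _ k₁) (sym x₁≡v₁) p₁ , step adj p₂ ,
    trans (+-suc k₁ k₂) (cong suc k₁+k₂≡k)
  project (step (inj₂ (x₂≡v₂ , adj)) p) with project p
  ... | k₁ , k₂ , p₁ , p₂ , k₁+k₂≡k =
    suc k₁ , k₂ , step adj p₁ , subst (λ s → Walk H s _ k₂) (sym x₂≡v₂) p₂ , cong suc k₁+k₂≡k

  product-distance : ∀ {a b e f} → IsDistanceTo G a e → IsDistanceTo H b f →
    IsDistanceTo (G □ H) (combine a b) (λ x → e (fst x) + f (snd x))
  product-distance {a} {b} {e} {f} distG distH x = walk , shortest
    where
    walk : Walk (G □ H) x (combine a b) (e (fst x) + f (snd x))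
    walk = subst (λ z → Walk (G □ H) z (combine a b) (e (fst x) + f (snd x))) (combine-fst-snd x)
                 (lift₁ (snd x) (proj₁ (distG (fst x))) ++ʷ lift₂ a (proj₁ (distH (snd x))))
    shortest : ∀ k → Walk (G □ H) x (combine a b) k → e (fst x) + f (snd x) ≤ k
    shortest k p with project p
    ... | k₁ , k₂ , p₁ , p₂ , k₁+k₂≡k = subst (_ ≤_) k₁+k₂≡k (+-mono-≤
      (proj₂ (distG (fst x)) k₁ (subst (λ t → Walk G (fst x) t k₁) (fst-combine a b) p₁))
      (proj₂ (distH (snd x)) k₂ (subst (λ t → Walk H (snd x) t k₂) (snd-combine a b) p₂)))

  fibre₁-distance : ∀ {a b d} → IsDistanceTo (G □ H) (combine a b) d →
    IsDistanceTo G a (λ w → d (combine w b))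
  fibre₁-distance {a} {b} {d} dist w with project (proj₁ (dist (combine w b)))
  ... | k₁ , k₂ , p₁ , _ , k₁+k₂≡d =
    IsDist-intro (λ l p → proj₂ (dist (combine w b)) l (lift₁ b p))
                 (subst₂ (λ s t → Walk G s t k₁) (fst-combine w b) (fst-combine a b) p₁)
                 (subst (k₁ ≤_) k₁+k₂≡d (m≤m+n k₁ k₂))

  fibre₂-distance : ∀ {a b d} → IsDistanceTo (G □ H) (combine a b) d →
    IsDistanceTo H b (λ z → d (combine a z))
  fibre₂-distance {a} {b} {d} dist z with project (proj₁ (dist (combine a z)))
  ... | k₁ , k₂ , _ , p₂ , k₁+k₂≡d =
    IsDist-intro (λ l p → proj₂ (dist (combine a z)) l (lift₂ a p))
                 (subst₂ (λ s t → Walk H s t k₂) (snd-combine a z) (snd-combine a b) p₂)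
                 (subst (k₂ ≤_) k₁+k₂≡d (m≤n+m k₂ k₁))

  weight-product : (e : Fin (n G) → ℕ) (f : Fin (n H) → ℕ) →
    weight {n (G □ H)} (λ x → e (fst x) + f (snd x)) ≡ weight e * weight f
  weight-product e f = begin
    weight {n (G □ H)} (λ x → e (fst x) + f (snd x))
      ≡⟨ sumFin-combine (n G) (n H) _ ⟩
    sumFin {n G} (λ i → sumFin {n H} (λ j → 2 ^ (e (fst (combine i j)) + f (snd (combine i j)))))
      ≡⟨ sumFin-cong (λ i → sumFin-cong (λ j → cong₂ (λ s t → 2 ^ (e s + f t)) (fst-combine i j) (snd-combine i j))) ⟩
    sumFin (λ i → sumFin (λ j → 2 ^ (e i + f j)))
      ≡⟨ sumFin-cong (λ i → sumFin-cong (λ j → ^-distribˡ-+-* 2 (e i) (f j))) ⟩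
    sumFin (λ i → sumFin (λ j → 2 ^ e i * 2 ^ f j))
      ≡⟨ sumFin-cong (λ i → sumFin-distribˡ-* (2 ^ e i) (λ j → 2 ^ f j)) ⟩
    sumFin (λ i → 2 ^ e i * weight f)
      ≡⟨ sumFin-distribʳ-* (weight f) (λ i → 2 ^ e i) ⟩
    weight e * weight f
      ∎
    where open ≡-Reasoning

  good-product-cover-≤ : Undirected G → Undirected H → Good (G □ H) →
    ∀ {γ M N} → IsCoverPebblingNumber (G □ H) γ → AllCoverSolvable G M → AllCoverSolvable H N →
    γ ≤ M * N
  good-product-cover-≤ undirectedG undirectedH (u , d , dist , isCover) {γ} {M} {N}
                       isCoverγ solvableG solvableH =
    begin
      γ                                                 ≡⟨ cover-number-unique isCoverγ isCover ⟩
      weight d                                          ≡⟨ sumFin-cong (cong (2 ^_) ∘ split) ⟩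
      weight {n (G □ H)} (λ x → e (fst x) + f (snd x))  ≡⟨ weight-product e f ⟩
      weight e * weight f                               ≤⟨ *-mono-≤ (distance-weight-≤-cover undirectedG distG solvableG)
                                                                    (distance-weight-≤-cover undirectedH distH solvableH) ⟩
      M * N                                             ∎
    where
    open ≤-Reasoning
    a : Fin (n G)
    a = fst u
    b : Fin (n H)
    b = snd u
    dist′ : IsDistanceTo (G □ H) (combine a b) d
    dist′ = subst (λ z → IsDistanceTo (G □ H) z d) (sym (combine-fst-snd u)) dist
    e : Fin (n G) → ℕ
    e w = d (combine w b)
    f : Fin (n H) → ℕ
    f z = d (combine a z)
    distG : IsDistanceTo G a e
    distG = fibre₁-distance dist′
    distH : IsDistanceTo H b f
    distH = fibre₂-distance dist′
    split : ∀ x → d x ≡ e (fst x) + f (snd x)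
    split x = IsDist-unique (dist′ x) (product-distance distG distH x)

theorem4p2 : (G H : Graph) → IsFiniteSimpleConnected G → IsFiniteSimpleConnected H →
    Good G → Good H →
    (γG γH γGH : ℕ) → IsCoverPebblingNumber G γG → IsCoverPebblingNumber H γH →
    IsCoverPebblingNumber (G □ H) γGH →
    ((γGH ≡ γG * γH → Good (G □ H)) × (Good (G □ H) → γGH ≡ γG * γH))
theorem4p2 G H (undirectedG , _ , _) (undirectedH , _ , _) (a , dG , distG , isCoverG′) (b , dH , distH , isCoverH′)
  γG γH γGH isCoverG isCoverH isCoverGH = equality⇒good , good⇒equality
  where
  open Product G H
  distGH : IsDistanceTo (G □ H) (combine a b) (λ x → dG (fst x) + dH (snd x))
  distGH = product-distance distG distH
  weight-distGH : weight {n (G □ H)} (λ x → dG (fst x) + dH (snd x)) ≡ γG * γH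
  weight-distGH = trans (weight-product dG dH)
    (cong₂ _*_ (cover-number-unique isCoverG′ isCoverG) (cover-number-unique isCoverH′ isCoverH))
  equality⇒good : γGH ≡ γG * γH → Good (G □ H)
  equality⇒good γGH≡ = combine a b , _ , distGH ,
    subst (IsCoverPebblingNumber (G □ H)) (trans γGH≡ (sym weight-distGH)) isCoverGH
  good⇒equality : Good (G □ H) → γGH ≡ γG * γH
  good⇒equality good = ≤-antisym
    (good-product-cover-≤ undirectedG undirectedH good isCoverGH (proj₁ isCoverG) (proj₁ isCoverH))
    (subst (_≤ γGH) weight-distGH
      (distance-weight-≤-cover (□-undirected undirectedG undirectedH) distGH (proj₁ isCoverGH)))
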